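{- A polynomial umbra $\sigma_x$ is a Sheffer umbra if and only if there exists a scalar umbra $\eta$ provided with a compositional inverse such that $$\sigma_{\eta+x.u}\equiv\chi+\sigma_x,$$ where $\chi$ and $\sigma_x$ are uncorrelated.
   Context: Setting (classical umbral calculus). $R$ is a commutative integral domain whose quotient field has characteristic $0$. Umbrae are symbols with a linear evaluation $E$, $E[1]=1$, multiplicative on products of powers of pairwise distinct umbrae. Moments $a_n=E[\alpha^n]$, g.f. $f(\alpha,t)=\sum a_nt^n/n!$; $\alpha\equiv\gamma$ iff equal moments (equal g.f.). Saturation: umbral expressions denote auxiliary umbrae determined up to similarity by their g.f.; distinct ones in a sum are uncorrelated. Special umbrae: unity $u$ ($e^t$), singleton $\chi$ ($1+t$), Bell $\beta$ ($\exp(e^t-1)$). G.f. rules: $f(\alpha+\gamma,t)=f(\alpha,t)f(\gamma,t)$; for a scalar $c$ (integer or indeterminate) $f(c.\alpha,t)=f(\alpha,t)^c$ (so $x.u$ has moments $x^n$); $f(\gamma.\alpha,t)=f(\gamma,\log f(\alpha,t))$; dot-products associate. $\gamma$ is provided with a compositional inverse if $E[\gamma]\ne0$ and $f(\gamma,t)-1$ has a compositional inverse series $h_\gamma$; then $\gamma^{<-1>}$ has g.f. $1+h_\gamma$ and $\gamma^*=\beta.\gamma^{<-1>}$ (g.f. $\exp(h_\gamma)$). A scalar umbra has moments in $R$. A polynomial umbra $\sigma_x$ has moments $s_n(x)=\sum_k s_{n,k}x^k\in R[x]$, $s_0=1$, $\deg s_n=n$; for an umbra $\zeta$ (possibly polynomial,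 e.g. $\eta+x.u$), $\sigma_\zeta$ has moments $E[s_n(\zeta)]=\sum_k s_{n,k}E[\zeta^k]$. $\sigma_x$ is a Sheffer umbra if there are scalar umbrae $\alpha,\gamma$, $\gamma$ provided with a compositional inverse, with $\sigma_x\equiv(-1.\alpha+x.u).\gamma^*$. -}

module Defs where

-- An umbra is represented by its sequence of moments (n ↦ E[α^n]);
-- its generating function f(α,t) = Σ a_n t^n/n! is thus an
-- exponential generating function (EGF) whose coefficients are the
-- moments.  All g.f. rules of the paper are realised by the
-- corresponding operations on EGF coefficient sequences; these need
-- only integer coefficients (binomial coefficients, partial Bell
-- polynomials), so no division is required.

open import Level using (Level; _⊔_)
open import Data.Nat using (ℕ; zero; suc; _<_; _!; _≡ᵇ_)
open import Data.Nat.Combinatorics using (_C_)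
open import Data.Bool using (if_then_else_)
open import Data.Product using (_×_; ∃)
open import Data.Sum using (_⊎_)
open import Relation.Nullary using (¬_)
open import Algebra.Bundles using (CommutativeRing)
open import Algebra.Bundles.Raw using (RawRing)

module EGF {a ℓ : Level} (A : RawRing a ℓ) where
  open RawRing A

  Seq : Set a
  Seq = ℕ → Carrier

  _×ₙ_ : ℕ → Carrier → Carrier
  zero  ×ₙ x = 0#
  suc n ×ₙ x = x + (n ×ₙ x)

  sumTo : ℕ → (ℕ → Carrier) → Carrier
  sumTo zero    f = f zero
  sumTo (suc n) f = sumTo n f + f (suc n)

  sgn : ℕ → Carrier
  sgn zero    = 1#
  sgn (suc k) = - sgn k

  -- partial Bell polynomial  bell h k n = B_{n,k}(h_1, h_2, …):
  -- the EGF coefficient of  h(t)^k / k!  (h_0 is ignored).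
  bell : Seq → ℕ → ℕ → Carrier
  bell h zero    zero    = 1#
  bell h zero    (suc n) = 0#
  bell h (suc k) zero    = 0#
  bell h (suc k) (suc n) =
    sumTo n (λ i → (n C i) ×ₙ (h (suc i) * bell h k (n Data.Nat.∸ i)))

  -- composition of EGFs:  (g ∘ h)(t) = Σ_k g_k h(t)^k / k!,
  -- for h with zero constant term (h_0 is ignored).
  compose : Seq → Seq → Seq
  compose g h n = sumTo n (λ k → g k * bell h k n)

  idSeries : Seq
  idSeries n = if n ≡ᵇ 1 then 1# else 0#

  -- f(α+γ,t) = f(α,t) f(γ,t)  (α, γ uncorrelated): binomial convolution
  _⊕_ : Seq → Seq → Seq
  (x ⊕ y) n = sumTo n (λ j → (n C j) ×ₙ (x j * y (n Data.Nat.∸ j)))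

  -- f(-1.α,t) = f(α,t)^{-1} = 1/(1 + (f(α,t)-1)) ;
  -- 1/(1+t) has EGF coefficients (-1)^k k!
  neg1 : Seq → Seq
  neg1 x = compose (λ k → sgn k * ((k !) ×ₙ 1#)) x

  -- log f(α,t) = log(1 + (f(α,t)-1)) ;
  -- log(1+t) has EGF coefficients 0, and (-1)^{k-1}(k-1)! for k ≥ 1
  logS : Seq → Seq
  logS x = compose coeff x
    where
    coeff : Seq
    coeff zero    = 0#
    coeff (suc j) = sgn j * ((j !) ×ₙ 1#)

  -- dot product  f(γ.α,t) = f(γ, log f(α,t))
  dot : Seq → Seq → Seq
  dot g x = compose g (logS x)

  -- Bell umbra β:  f(β,t) = exp(e^t - 1)
  bellUmbra : Seq
  bellUmbra = compose (λ _ → 1#) (λ _ → 1#)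

  chi : Seq
  chi zero          = 1#
  chi (suc zero)    = 1#
  chi (suc (suc n)) = 0#

-- Polynomials A[x] as coefficient functions (coefficient of x^k),
-- with pointwise equality.

module Poly {a ℓ : Level} (A : RawRing a ℓ) where
  open RawRing A
  open EGF A using (sumTo)

  Pol : Set a
  Pol = ℕ → Carrier

  polyRawRing : RawRing a ℓ
  polyRawRing = record
    { Carrier = Pol
    ; _≈_     = λ p q → ∀ k → p k ≈ q k
    ; _+_     = λ p q k → p k + q k
    ; _*_     = λ p q k → sumTo k (λ i → p i * q (k Data.Nat.∸ i))
    ; -_      = λ p k → - p k
    ; 0#      = λ _ → 0#
    ; 1#      = const 1#
    }
    where
    const : Carrier → Pol
    const r zero    = r
    const r (suc k) = 0#

  const : Carrier → Pol
  const r zero    = r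
  const r (suc k) = 0#

  monomial : ℕ → Pol
  monomial n k = if k ≡ᵇ n then 1# else 0#

module Umbral {c ℓ : Level} (R : CommutativeRing c ℓ) where
  open CommutativeRing R
  open EGF rawRing public
  module P = Poly rawRing
  module EP = EGF P.polyRawRing

  IsIntegralDomain : Set (c ⊔ ℓ)
  IsIntegralDomain =
    (¬ (1# ≈ 0#)) × (∀ x y → (x * y) ≈ 0# → (x ≈ 0#) ⊎ (y ≈ 0#))

  -- the quotient field of the domain R has characteristic 0
  -- (equivalently: n·1 ≠ 0 in R for all n ≥ 1)
  QuotientFieldCharZero : Set ℓ
  QuotientFieldCharZero = ∀ n → ¬ ((suc n ×ₙ 1#) ≈ 0#)

  ScalarUmbra : Seq → Set ℓ
  ScalarUmbra x = x 0 ≈ 1#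

  fMinus1 : Seq → Seq
  fMinus1 x zero    = 0#
  fMinus1 x (suc n) = x (suc n)

  IsCompInverse : Seq → Seq → Set ℓ
  IsCompInverse x h =
    (h 0 ≈ 0#) ×
    (∀ n → compose (fMinus1 x) h n ≈ idSeries n) ×
    (∀ n → compose h (fMinus1 x) n ≈ idSeries n)

  ProvidedWithCompInverse : Seq → Set (c ⊔ ℓ)
  ProvidedWithCompInverse x = (¬ (x 1 ≈ 0#)) × ∃ (IsCompInverse x)

  compInvUmbra : Seq → Seq
  compInvUmbra h zero    = 1#
  compInvUmbra h (suc n) = h (suc n)

  star : Seq → Seq
  star h = dot bellUmbra (compInvUmbra h)

  -- polynomial umbra σ_x with moments s_n(x) = Σ_k s n k x^k,
  -- s_0 = 1 and deg s_n = n
  PolynomialUmbra : (ℕ → ℕ → Carrier) → Set ℓ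
  PolynomialUmbra s =
    (s 0 0 ≈ 1#) ×
    (∀ n k → n < k → s n k ≈ 0#) ×
    (∀ n → ¬ (s n n ≈ 0#))

  PSeq : Set c
  PSeq = ℕ → P.Pol

  _≡ᵤ_ : PSeq → PSeq → Set ℓ
  m ≡ᵤ m' = ∀ n k → m n k ≈ m' n k

  embed : Seq → PSeq
  embed x n = P.const (x n)

  xu : PSeq
  xu = P.monomial

  -- σ_ζ : moments E[s_n(ζ)] = Σ_k s_{n,k} E[ζ^k]
  substUmbra : (ℕ → ℕ → Carrier) → PSeq → PSeq
  substUmbra s ζ n = EP.sumTo n (λ k → RawRing._*_ P.polyRawRing (P.const (s n k)) (ζ k))

  -- moments of (-1.α + x.u).γ^*, where h = h_γ
  shefferMoments : Seq → Seq → PSeq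
  shefferMoments α h = EP.dot (EP._⊕_ (EP.neg1 (embed α)) xu) (embed (star h))

  IsSheffer : (ℕ → ℕ → Carrier) → Set (c ⊔ ℓ)
  IsSheffer s =
    ∃ λ α → ∃ λ γ → ∃ λ h →
      ScalarUmbra α × ScalarUmbra γ × (¬ (γ 1 ≈ 0#)) × IsCompInverse γ h ×
      (s ≡ᵤ shefferMoments α h)

  SheffCondition : (ℕ → ℕ → Carrier) → Set (c ⊔ ℓ)
  SheffCondition s =
    ∃ λ η → ScalarUmbra η × ProvidedWithCompInverse η ×
      (substUmbra s (EP._⊕_ (embed η) xu) ≡ᵤ EP._⊕_ (embed chi) s)

-- Since log f(γ*,t) = h_γ(t), the moments of (−1.α + x.u).γ* have EGF A(t) exp(x h(t)) with
-- h = h_γ and A(t) = f(α,h(t))⁻¹, so s_{n,k} is the t^n/n! coefficient of A(t) h(t)^k/k!.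
-- Replacing x by η + x with η = γ multiplies this EGF by f(γ,h(t)) = 1 + t, which gives
-- the moments of χ + σ_x.
-- Conversely, read coefficientwise in x, the condition is for each n a linear system for the
-- row (s_{n,k})_k whose matrix (C(m,k) η_{m−k})_{k,m} is unitriangular with superdiagonal
-- entries (k+1) η_1 ≠ 0. In a domain of characteristic 0 it determines row n from row n − 1
-- and s_{n,0}. The Sheffer sequence with h = h_η and A(t) = Σ s_{n,0} t^n/n! satisfies the
-- same condition, hence equals s.

module Submission where

open import Defs
open import Level using (Level)
open import Algebra.Bundles using (CommutativeRing)
open import Algebra.Bundles.Raw using (RawRing)
open import Data.Nat as ℕ using (ℕ; zero; suc; pred; _≤_; _<_; z≤n; s≤s; _∸_; _!)
import Data.Nat.Properties as ℕ
open import Data.Nat.Combinatorics using (_C_; nC1≡n; nCk+nC[k+1]≡[n+1]C[k+1]; k>n⇒nCk≡0)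
open import Data.Sum using (inj₁; inj₂)
open import Data.Product using (_,_)
open import Data.Empty using (⊥-elim)
open import Data.Bool as Bool using (true; false)
open import Function using (_∘_)
open import Function.Bundles using (_⇔_; mk⇔)
open import Relation.Nullary using (yes; no; ¬_)
open import Relation.Binary.PropositionalEquality as ≡ using (_≡_; _≢_)

module _ {c ℓ : Level} (R : CommutativeRing c ℓ) where
  open CommutativeRing R
  open Umbral R
  open import Relation.Binary.Reasoning.Setoid setoid
  open import Algebra.Properties.Ring ring
    using ( -‿distribˡ-*; [y-z]x≈yx-zx; -‿+-comm; +-identityʳ-unique
          ; x∙y⁻¹≈ε⇒x≈y; x≈y⇒x∙y⁻¹≈ε )
  open import Algebra.Properties.CommutativeSemigroup +-commutativeSemigroup
    using (interchange; x∙yz≈y∙xz)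
  open import Algebra.Properties.CommutativeSemigroup *-commutativeSemigroup
    using ()
    renaming (x∙yz≈y∙xz to x*yz≈y*xz; xy∙z≈xz∙y to xy*z≈xz*y; xy∙z≈x∙zy to xy*z≈x*zy)
  open import Algebra.Properties.Semiring.Mult semiring
    using (_×_; ×-congʳ; ×-homo-+; ×-assoc-*; ×-comm-*; ×-assocˡ)
  open import Algebra.Properties.CommutativeMonoid.Mult +-commutativeMonoid
    using (×-distrib-+)

  -- Natural-number multiples and finite sums

  ×ₙ≈× : ∀ n x → n ×ₙ x ≈ n × x
  ×ₙ≈× zero    x = refl
  ×ₙ≈× (suc n) x = +-congˡ (×ₙ≈× n x)

  ×ₙ-congʳ : ∀ n {x y} → x ≈ y → n ×ₙ x ≈ n ×ₙ y
  ×ₙ-congʳ n {x} {y} x≈y = trans (×ₙ≈× n x) (trans (×-congʳ n x≈y) (sym (×ₙ≈× n y)))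

  ×ₙ-congˡ : ∀ {m n} → m ≡ n → ∀ x → m ×ₙ x ≈ n ×ₙ x
  ×ₙ-congˡ ≡.refl x = refl

  ×ₙ-zeroʳ : ∀ n → n ×ₙ 0# ≈ 0#
  ×ₙ-zeroʳ zero    = refl
  ×ₙ-zeroʳ (suc n) = trans (+-identityˡ _) (×ₙ-zeroʳ n)

  ×ₙ-vanish : ∀ n {x} → x ≈ 0# → n ×ₙ x ≈ 0#
  ×ₙ-vanish n x≈0 = trans (×ₙ-congʳ n x≈0) (×ₙ-zeroʳ n)

  ×ₙ-homo-1 : ∀ x → 1 ×ₙ x ≈ x
  ×ₙ-homo-1 = +-identityʳ

  ×ₙ-homo-+ : ∀ x m n → (m ℕ.+ n) ×ₙ x ≈ m ×ₙ x + n ×ₙ x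
  ×ₙ-homo-+ x m n = trans (×ₙ≈× (m ℕ.+ n) x)
    (trans (×-homo-+ x m n) (sym (+-cong (×ₙ≈× m x) (×ₙ≈× n x))))

  ×ₙ-distrib-+ : ∀ x y n → n ×ₙ (x + y) ≈ n ×ₙ x + n ×ₙ y
  ×ₙ-distrib-+ x y n = trans (×ₙ≈× n _)
    (trans (×-distrib-+ x y n) (sym (+-cong (×ₙ≈× n x) (×ₙ≈× n y))))

  ×ₙ-assocˡ : ∀ x m n → m ×ₙ (n ×ₙ x) ≈ (m ℕ.* n) ×ₙ x
  ×ₙ-assocˡ x m n = trans (×ₙ-congʳ m (×ₙ≈× n x))
    (trans (×ₙ≈× m _) (trans (×-assocˡ x m n) (sym (×ₙ≈× (m ℕ.* n) x))))

  ×ₙ-assoc-* : ∀ n x y → (n ×ₙ x) * y ≈ n ×ₙ (x * y)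
  ×ₙ-assoc-* n x y = trans (*-congʳ (×ₙ≈× n x))
    (trans (×-assoc-* n x y) (sym (×ₙ≈× n _)))

  ×ₙ-comm-* : ∀ n x y → x * (n ×ₙ y) ≈ n ×ₙ (x * y)
  ×ₙ-comm-* n x y = trans (*-congˡ (×ₙ≈× n y))
    (trans (×-comm-* n x y) (sym (×ₙ≈× n _)))

  Σ-cong-≤ : ∀ n {f g : ℕ → Carrier} → (∀ i → i ≤ n → f i ≈ g i) → sumTo n f ≈ sumTo n g
  Σ-cong-≤ zero    f≈g = f≈g 0 z≤n
  Σ-cong-≤ (suc n) f≈g =
    +-cong (Σ-cong-≤ n (λ i i≤n → f≈g i (ℕ.m≤n⇒m≤1+n i≤n))) (f≈g (suc n) ℕ.≤-refl)

  Σ-cong : ∀ n {f g : ℕ → Carrier} → (∀ i → f i ≈ g i) → sumTo n f ≈ sumTo n g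
  Σ-cong n f≈g = Σ-cong-≤ n (λ i _ → f≈g i)

  Σ-zero : ∀ n {f : ℕ → Carrier} → (∀ i → i ≤ n → f i ≈ 0#) → sumTo n f ≈ 0#
  Σ-zero zero    f≈0 = f≈0 0 z≤n
  Σ-zero (suc n) f≈0 = trans
    (+-cong (Σ-zero n (λ i i≤n → f≈0 i (ℕ.m≤n⇒m≤1+n i≤n))) (f≈0 (suc n) ℕ.≤-refl))
    (+-identityˡ 0#)

  Σ-distrib-+ : ∀ n f g → sumTo n (λ i → f i + g i) ≈ sumTo n f + sumTo n g
  Σ-distrib-+ zero    f g = refl
  Σ-distrib-+ (suc n) f g = trans (+-congʳ (Σ-distrib-+ n f g)) (interchange _ _ _ _)

  Σ-distribˡ-* : ∀ n x f → x * sumTo n f ≈ sumTo n (λ i → x * f i)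
  Σ-distribˡ-* zero    x f = refl
  Σ-distribˡ-* (suc n) x f = trans (distribˡ x _ _) (+-congʳ (Σ-distribˡ-* n x f))

  Σ-distribʳ-* : ∀ n x f → sumTo n f * x ≈ sumTo n (λ i → f i * x)
  Σ-distribʳ-* n x f =
    trans (*-comm _ x) (trans (Σ-distribˡ-* n x f) (Σ-cong n (λ i → *-comm x (f i))))

  ×ₙ-distrib-Σ : ∀ n k f → k ×ₙ sumTo n f ≈ sumTo n (λ i → k ×ₙ f i)
  ×ₙ-distrib-Σ zero    k f = refl
  ×ₙ-distrib-Σ (suc n) k f = trans (×ₙ-distrib-+ _ _ k) (+-congʳ (×ₙ-distrib-Σ n k f))

  -‿distrib-Σ : ∀ n f → - sumTo n f ≈ sumTo n (λ i → - f i)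
  -‿distrib-Σ zero    f = refl
  -‿distrib-Σ (suc n) f = trans (sym (-‿+-comm _ _)) (+-congʳ (-‿distrib-Σ n f))

  Σ-distrib-sub : ∀ n f g → sumTo n (λ i → f i - g i) ≈ sumTo n f - sumTo n g
  Σ-distrib-sub n f g = trans (Σ-distrib-+ n f _) (+-congˡ (sym (-‿distrib-Σ n g)))

  Σ-unfoldˡ : ∀ n f → sumTo (suc n) f ≈ f 0 + sumTo n (λ i → f (suc i))
  Σ-unfoldˡ zero    f = refl
  Σ-unfoldˡ (suc n) f = trans (+-congʳ (Σ-unfoldˡ n f)) (+-assoc _ _ _)

  Σ-comm : ∀ n m (f : ℕ → ℕ → Carrier) →
    sumTo n (λ i → sumTo m (f i)) ≈ sumTo m (λ j → sumTo n (λ i → f i j))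
  Σ-comm zero    m f = refl
  Σ-comm (suc n) m f = trans (+-congʳ (Σ-comm n m f)) (sym (Σ-distrib-+ m _ _))

  Σ-truncate : ∀ {r} n {f : ℕ → Carrier} → r ≤ n →
    (∀ i → r < i → i ≤ n → f i ≈ 0#) → sumTo n f ≈ sumTo r f
  Σ-truncate zero    z≤n _ = refl
  Σ-truncate (suc n) r≤1+n f≈0 with ℕ.m≤n⇒m<n∨m≡n r≤1+n
  ... | inj₂ ≡.refl     = refl
  ... | inj₁ (s≤s r≤n) = trans
    (+-cong (Σ-truncate n r≤n (λ i r<i i≤n → f≈0 i r<i (ℕ.m≤n⇒m≤1+n i≤n)))
            (f≈0 (suc n) (s≤s r≤n) ℕ.≤-refl))
    (+-identityʳ _)

  Σ-head : ∀ n {f : ℕ → Carrier} → (∀ i → 0 < i → i ≤ n → f i ≈ 0#) → sumTo n f ≈ f 0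
  Σ-head n = Σ-truncate n z≤n

  Σ-last : ∀ n {f : ℕ → Carrier} → (∀ i → i < n → f i ≈ 0#) → sumTo n f ≈ f n
  Σ-last zero    _   = refl
  Σ-last (suc n) f≈0 = trans (+-congʳ (Σ-zero n (λ i i≤n → f≈0 i (s≤s i≤n)))) (+-identityˡ _)

  Σ-single : ∀ n k {f : ℕ → Carrier} → k ≤ n → (∀ i → i ≤ n → i ≢ k → f i ≈ 0#) →
    sumTo n f ≈ f k
  Σ-single n k k≤n f≈0 = trans
    (Σ-truncate n k≤n (λ i k<i i≤n → f≈0 i i≤n (ℕ.>⇒≢ k<i)))
    (Σ-last k (λ i i<k → f≈0 i (ℕ.≤-trans (ℕ.<⇒≤ i<k) k≤n) (ℕ.<⇒≢ i<k)))

  -- Binomial convolution of EGFs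

  infix 4 _≈ˢ_ _≈[_]_
  infixl 6 _+ˢ_

  _≈ˢ_ : Seq → Seq → Set ℓ
  a ≈ˢ b = ∀ n → a n ≈ b n

  _≈[_]_ : Seq → ℕ → Seq → Set ℓ
  a ≈[ n ] b = ∀ m → m ≤ n → a m ≈ b m

  _+ˢ_ : Seq → Seq → Seq
  (a +ˢ b) n = a n + b n

  0ˢ : Seq
  0ˢ _ = 0#

  1ˢ : Seq
  1ˢ zero    = 1#
  1ˢ (suc n) = 0#

  -- Differentiation of EGFs.
  D : Seq → Seq
  D a n = a (suc n)

  ⊕-zero-index : ∀ a b → (a ⊕ b) 0 ≈ a 0 * b 0
  ⊕-zero-index a b = +-identityʳ _

  ⊕-cong-≤ : ∀ n {a a' b b'} → a ≈[ n ] a' → b ≈[ n ] b' → (a ⊕ b) n ≈ (a' ⊕ b') n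
  ⊕-cong-≤ n a≈a' b≈b' = Σ-cong-≤ n (λ j j≤n →
    ×ₙ-congʳ (n C j) (*-cong (a≈a' j j≤n) (b≈b' (n ∸ j) (ℕ.m∸n≤m n j))))

  ⊕-congˡ : ∀ a {b b'} → b ≈ˢ b' → (a ⊕ b) ≈ˢ (a ⊕ b')
  ⊕-congˡ a b≈b' n = ⊕-cong-≤ n {a} {a} (λ _ _ → refl) (λ m _ → b≈b' m)

  ⊕-congʳ : ∀ b {a a'} → a ≈ˢ a' → (a ⊕ b) ≈ˢ (a' ⊕ b)
  ⊕-congʳ b a≈a' n = ⊕-cong-≤ n {b = b} {b} (λ m _ → a≈a' m) (λ _ _ → refl)

  leibniz : ∀ a b n → (a ⊕ b) (suc n) ≈ (D a ⊕ b) n + (a ⊕ D b) n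
  leibniz a b n = begin
    (a ⊕ b) (suc n)                        ≈⟨ Σ-unfoldˡ n T ⟩
    T 0 + sumTo n (λ i → T (suc i))        ≈⟨ +-congˡ (Σ-cong n pascal) ⟩
    T 0 + sumTo n (λ i → F i + G i)        ≈⟨ +-congˡ (Σ-distrib-+ n F G) ⟩
    T 0 + (sumTo n F + sumTo n G)          ≈⟨ x∙yz≈y∙xz _ _ _ ⟩
    sumTo n F + (T 0 + sumTo n G)          ≈⟨ +-congˡ (sym (Σ-unfoldˡ n H)) ⟩
    sumTo n F + sumTo (suc n) H            ≈⟨ +-congˡ (Σ-truncate (suc n) (ℕ.n≤1+n n) H-top) ⟩
    sumTo n F + sumTo n H                  ≈⟨ +-congˡ (Σ-cong-≤ n H≈) ⟩
    (D a ⊕ b) n + (a ⊕ D b) n              ∎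
    where
    T F G H : ℕ → Carrier
    T j = (suc n C j) ×ₙ (a j * b (suc n ∸ j))
    F i = (n C i) ×ₙ (a (suc i) * b (n ∸ i))
    G i = (n C suc i) ×ₙ (a (suc i) * b (n ∸ i))
    H j = (n C j) ×ₙ (a j * b (suc n ∸ j))
    pascal : ∀ i → T (suc i) ≈ F i + G i
    pascal i = trans (×ₙ-congˡ (≡.sym (nCk+nC[k+1]≡[n+1]C[k+1] n i)) _)
                     (×ₙ-homo-+ _ (n C i) (n C suc i))
    H-top : ∀ i → n < i → i ≤ suc n → H i ≈ 0#
    H-top i n<i i≤1+n with ℕ.≤-antisym i≤1+n n<i
    ... | ≡.refl = ×ₙ-congˡ (k>n⇒nCk≡0 {n} {suc n} ℕ.≤-refl) _
    H≈ : ∀ j → j ≤ n → H j ≈ (n C j) ×ₙ (a j * D b (n ∸ j))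
    H≈ j j≤n = ×ₙ-congʳ (n C j) (*-congˡ (reflexive (≡.cong b (ℕ.+-∸-assoc 1 j≤n))))

  ⊕-distribʳ : ∀ a b c → ((a +ˢ b) ⊕ c) ≈ˢ ((a ⊕ c) +ˢ (b ⊕ c))
  ⊕-distribʳ a b c n = trans
    (Σ-cong n (λ j → trans (×ₙ-congʳ (n C j) (distribʳ _ _ _)) (×ₙ-distrib-+ _ _ (n C j))))
    (Σ-distrib-+ n _ _)

  ⊕-distribˡ : ∀ a b c → (a ⊕ (b +ˢ c)) ≈ˢ ((a ⊕ b) +ˢ (a ⊕ c))
  ⊕-distribˡ a b c n = trans
    (Σ-cong n (λ j → trans (×ₙ-congʳ (n C j) (distribˡ _ _ _)) (×ₙ-distrib-+ _ _ (n C j))))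
    (Σ-distrib-+ n _ _)

  ⊕-zeroˡ : ∀ a → (0ˢ ⊕ a) ≈ˢ 0ˢ
  ⊕-zeroˡ a n = Σ-zero n (λ j _ → ×ₙ-vanish (n C j) (zeroˡ _))

  ⊕-comm : ∀ a b → (a ⊕ b) ≈ˢ (b ⊕ a)
  ⊕-comm a b zero = trans (⊕-zero-index a b) (trans (*-comm _ _) (sym (⊕-zero-index b a)))
  ⊕-comm a b (suc n) = begin
    (a ⊕ b) (suc n)           ≈⟨ leibniz a b n ⟩
    (D a ⊕ b) n + (a ⊕ D b) n ≈⟨ +-cong (⊕-comm (D a) b n) (⊕-comm a (D b) n) ⟩
    (b ⊕ D a) n + (D b ⊕ a) n ≈⟨ +-comm _ _ ⟩
    (D b ⊕ a) n + (b ⊕ D a) n ≈⟨ leibniz b a n ⟨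
    (b ⊕ a) (suc n)           ∎

  ⊕-assoc : ∀ a b c → ((a ⊕ b) ⊕ c) ≈ˢ (a ⊕ (b ⊕ c))
  ⊕-assoc a b c zero = begin
    ((a ⊕ b) ⊕ c) 0    ≈⟨ trans (⊕-zero-index (a ⊕ b) c) (*-congʳ (⊕-zero-index a b)) ⟩
    (a 0 * b 0) * c 0  ≈⟨ *-assoc _ _ _ ⟩
    a 0 * (b 0 * c 0)  ≈⟨ trans (⊕-zero-index a (b ⊕ c)) (*-congˡ (⊕-zero-index b c)) ⟨
    (a ⊕ (b ⊕ c)) 0    ∎
  ⊕-assoc a b c (suc n) = begin
    ((a ⊕ b) ⊕ c) (suc n)
      ≈⟨ leibniz (a ⊕ b) c n ⟩
    (D (a ⊕ b) ⊕ c) n + ((a ⊕ b) ⊕ D c) n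
      ≈⟨ +-congʳ (trans (⊕-congʳ c (leibniz a b) n) (⊕-distribʳ _ _ c n)) ⟩
    (((D a ⊕ b) ⊕ c) n + ((a ⊕ D b) ⊕ c) n) + ((a ⊕ b) ⊕ D c) n
      ≈⟨ +-cong (+-cong (⊕-assoc (D a) b c n) (⊕-assoc a (D b) c n)) (⊕-assoc a b (D c) n) ⟩
    ((D a ⊕ (b ⊕ c)) n + (a ⊕ (D b ⊕ c)) n) + (a ⊕ (b ⊕ D c)) n
      ≈⟨ +-assoc _ _ _ ⟩
    (D a ⊕ (b ⊕ c)) n + ((a ⊕ (D b ⊕ c)) n + (a ⊕ (b ⊕ D c)) n)
      ≈⟨ +-congˡ (trans (⊕-congˡ a (leibniz b c) n) (⊕-distribˡ a (D b ⊕ c) (b ⊕ D c) n)) ⟨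
    (D a ⊕ (b ⊕ c)) n + (a ⊕ D (b ⊕ c)) n
      ≈⟨ leibniz a (b ⊕ c) n ⟨
    (a ⊕ (b ⊕ c)) (suc n)
      ∎

  ⊕-identityˡ : ∀ a → (1ˢ ⊕ a) ≈ˢ a
  ⊕-identityˡ a zero = trans (⊕-zero-index 1ˢ a) (*-identityˡ _)
  ⊕-identityˡ a (suc n) = begin
    (1ˢ ⊕ a) (suc n)                  ≈⟨ leibniz 1ˢ a n ⟩
    (D 1ˢ ⊕ a) n + (1ˢ ⊕ D a) n       ≈⟨ +-cong (⊕-zeroˡ a n) (⊕-identityˡ (D a) n) ⟩
    0# + a (suc n)                    ≈⟨ +-identityˡ _ ⟩
    a (suc n)                         ∎

  ⊕-identityʳ : ∀ a → (a ⊕ 1ˢ) ≈ˢ a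
  ⊕-identityʳ a n = trans (⊕-comm a 1ˢ n) (⊕-identityˡ a n)

  ⊕-swapˡ : ∀ a b c → (a ⊕ (b ⊕ c)) ≈ˢ (b ⊕ (a ⊕ c))
  ⊕-swapˡ a b c n = begin
    (a ⊕ (b ⊕ c)) n ≈⟨ ⊕-assoc a b c n ⟨
    ((a ⊕ b) ⊕ c) n ≈⟨ ⊕-congʳ c (⊕-comm a b) n ⟩
    ((b ⊕ a) ⊕ c) n ≈⟨ ⊕-assoc b a c n ⟩
    (b ⊕ (a ⊕ c)) n ∎

  -- Composition of EGFs

  bell-vanish : ∀ h k n → n < k → bell h k n ≈ 0#
  bell-vanish h (suc k) zero    _         = refl
  bell-vanish h (suc k) (suc n) (s≤s n<k) = Σ-zero n (λ i _ → ×ₙ-vanish (n C i)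
    (trans (*-congˡ (bell-vanish h k (n ∸ i) (ℕ.≤-<-trans (ℕ.m∸n≤m n i) n<k))) (zeroʳ _)))

  bell-cong : ∀ {h h'} → D h ≈ˢ D h' → ∀ k n → bell h k n ≈ bell h' k n
  bell-cong h≈h' zero    zero    = refl
  bell-cong h≈h' zero    (suc n) = refl
  bell-cong h≈h' (suc k) zero    = refl
  bell-cong h≈h' (suc k) (suc n) =
    Σ-cong n (λ i → ×ₙ-congʳ (n C i) (*-cong (h≈h' i) (bell-cong h≈h' k (n ∸ i))))

  bell-zero : ∀ h → bell h 0 ≈ˢ 1ˢ
  bell-zero h zero    = refl
  bell-zero h (suc n) = refl

  compose-zero-index : ∀ g h → compose g h 0 ≈ g 0
  compose-zero-index g h = *-identityʳ _

  compose-cong-≤ : ∀ {g g'} h n → g ≈[ n ] g' → compose g h n ≈ compose g' h n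
  compose-cong-≤ h n g≈g' = Σ-cong-≤ n (λ k k≤n → *-congʳ (g≈g' k k≤n))

  compose-congʳ : ∀ {g g'} h → g ≈ˢ g' → compose g h ≈ˢ compose g' h
  compose-congʳ h g≈g' n = compose-cong-≤ h n (λ m _ → g≈g' m)

  compose-congˡ : ∀ g {h h'} → D h ≈ˢ D h' → compose g h ≈ˢ compose g h'
  compose-congˡ g h≈h' n = Σ-cong n (λ k → *-congˡ (bell-cong h≈h' k n))

  compose-distrib-+ : ∀ g g' h → compose (g +ˢ g') h ≈ˢ (compose g h +ˢ compose g' h)
  compose-distrib-+ g g' h n = trans (Σ-cong n (λ k → distribʳ _ _ _)) (Σ-distrib-+ n _ _)

  compose-*ʳ : ∀ g x a n → compose (λ m → g m * a) x n ≈ compose g x n * a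
  compose-*ʳ g x a n = trans (Σ-cong n (λ m → xy*z≈xz*y _ _ _)) (sym (Σ-distribʳ-* n a _))

  compose-extend : ∀ g h m n → m ≤ n → sumTo n (λ k → g k * bell h k m) ≈ compose g h m
  compose-extend g h m n m≤n =
    Σ-truncate n m≤n (λ k m<k _ → trans (*-congˡ (bell-vanish h k m m<k)) (zeroʳ _))

  compose-chain : ∀ g h n → compose g h (suc n) ≈ (D h ⊕ compose (D g) h) n
  compose-chain g h n = begin
    compose g h (suc n)
      ≈⟨ Σ-unfoldˡ n _ ⟩
    g 0 * 0# + sumTo n (λ k → g (suc k) * (D h ⊕ bell h k) n)
      ≈⟨ trans (+-congʳ (zeroʳ _)) (+-identityˡ _) ⟩
    sumTo n (λ k → g (suc k) * (D h ⊕ bell h k) n)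
      ≈⟨ Σ-cong n (λ k → trans (Σ-distribˡ-* n _ _) (Σ-cong n (λ j → trans
           (×ₙ-comm-* (n C j) _ _) (×ₙ-congʳ (n C j) (x*yz≈y*xz _ _ _))))) ⟩
    sumTo n (λ k → sumTo n (λ j → (n C j) ×ₙ (D h j * (g (suc k) * bell h k (n ∸ j)))))
      ≈⟨ Σ-comm n n _ ⟩
    sumTo n (λ j → sumTo n (λ k → (n C j) ×ₙ (D h j * (g (suc k) * bell h k (n ∸ j)))))
      ≈⟨ Σ-cong-≤ n (λ j j≤n → trans (sym (×ₙ-distrib-Σ n (n C j) _)) (×ₙ-congʳ (n C j)
           (trans (sym (Σ-distribˡ-* n _ _))
                  (*-congˡ (compose-extend (D g) h (n ∸ j) n (ℕ.m∸n≤m n j)))))) ⟩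
    (D h ⊕ compose (D g) h) n
      ∎

  -- Stated up to a bound so that induction on it can be applied to D a and D b.
  compose-homo-⊕-≤ : ∀ h n a b → compose (a ⊕ b) h ≈[ n ] (compose a h ⊕ compose b h)
  compose-homo-⊕-≤ h n a b zero _ = begin
    compose (a ⊕ b) h 0           ≈⟨ trans (compose-zero-index (a ⊕ b) h) (⊕-zero-index a b) ⟩
    a 0 * b 0                     ≈⟨ *-cong (compose-zero-index a h) (compose-zero-index b h) ⟨
    compose a h 0 * compose b h 0 ≈⟨ ⊕-zero-index (compose a h) (compose b h) ⟨
    (compose a h ⊕ compose b h) 0 ∎
  compose-homo-⊕-≤ h (suc n) a b (suc m) (s≤s m≤n) = begin
    compose (a ⊕ b) h (suc m)
      ≈⟨ compose-chain (a ⊕ b) h m ⟩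
    (D h ⊕ compose (D (a ⊕ b)) h) m
      ≈⟨ ⊕-congˡ (D h) (λ i → trans (compose-congʳ h (leibniz a b) i)
                                    (compose-distrib-+ (D a ⊕ b) (a ⊕ D b) h i)) m ⟩
    (D h ⊕ (compose (D a ⊕ b) h +ˢ compose (a ⊕ D b) h)) m
      ≈⟨ ⊕-cong-≤ m {D h} (λ _ _ → refl) (λ i i≤m → +-cong
           (compose-homo-⊕-≤ h n (D a) b i (ℕ.≤-trans i≤m m≤n))
           (compose-homo-⊕-≤ h n a (D b) i (ℕ.≤-trans i≤m m≤n))) ⟩
    (D h ⊕ ((compose (D a) h ⊕ B) +ˢ (A ⊕ compose (D b) h))) m
      ≈⟨ ⊕-distribˡ (D h) (compose (D a) h ⊕ B) (A ⊕ compose (D b) h) m ⟩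
    (D h ⊕ (compose (D a) h ⊕ B)) m + (D h ⊕ (A ⊕ compose (D b) h)) m
      ≈⟨ +-cong (sym (⊕-assoc (D h) (compose (D a) h) B m)) (⊕-swapˡ (D h) A (compose (D b) h) m) ⟩
    ((D h ⊕ compose (D a) h) ⊕ B) m + (A ⊕ (D h ⊕ compose (D b) h)) m
      ≈⟨ +-cong (⊕-congʳ B (compose-chain a h) m) (⊕-congˡ A (compose-chain b h) m) ⟨
    (D A ⊕ B) m + (A ⊕ D B) m
      ≈⟨ leibniz A B m ⟨
    (A ⊕ B) (suc m)
      ∎
    where
    A B : Seq
    A = compose a h
    B = compose b h

  compose-homo-⊕ : ∀ h a b → compose (a ⊕ b) h ≈ˢ (compose a h ⊕ compose b h)
  compose-homo-⊕ h a b n = compose-homo-⊕-≤ h n a b n ℕ.≤-refl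

  compose-assoc-≤ : ∀ k l n g → compose (compose g k) l ≈[ n ] compose g (compose k l)
  compose-assoc-≤ k l n g zero _ = trans (compose-zero-index (compose g k) l)
    (trans (compose-zero-index g k) (sym (compose-zero-index g (compose k l))))
  compose-assoc-≤ k l (suc n) g (suc m) (s≤s m≤n) = begin
    compose (compose g k) l (suc m)
      ≈⟨ compose-chain (compose g k) l m ⟩
    (D l ⊕ compose (D (compose g k)) l) m
      ≈⟨ ⊕-congˡ (D l) (λ i → trans (compose-congʳ l (compose-chain g k) i)
                                    (compose-homo-⊕ l (D k) (compose (D g) k) i)) m ⟩
    (D l ⊕ (compose (D k) l ⊕ compose (compose (D g) k) l)) m
      ≈⟨ ⊕-cong-≤ m {D l} (λ _ _ → refl) (λ i i≤m → ⊕-cong-≤ i {compose (D k) l}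
           (λ _ _ → refl)
           (λ j j≤i → compose-assoc-≤ k l n (D g) j
                        (ℕ.≤-trans j≤i (ℕ.≤-trans i≤m m≤n)))) ⟩
    (D l ⊕ (compose (D k) l ⊕ compose (D g) K)) m
      ≈⟨ ⊕-assoc (D l) (compose (D k) l) (compose (D g) K) m ⟨
    ((D l ⊕ compose (D k) l) ⊕ compose (D g) K) m
      ≈⟨ ⊕-congʳ (compose (D g) K) (compose-chain k l) m ⟨
    (D K ⊕ compose (D g) K) m
      ≈⟨ compose-chain g K m ⟨
    compose g K (suc m)
      ∎
    where
    K : Seq
    K = compose k l

  compose-assoc : ∀ g k l → compose (compose g k) l ≈ˢ compose g (compose k l)
  compose-assoc g k l n = compose-assoc-≤ k l n g n ℕ.≤-refl

  -- The EGF t^k/k!: the coefficient of x^k in the moments of x.u.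
  δ : ℕ → Seq
  δ k r = xu r k

  δ-diag : ∀ k → δ k k ≈ 1#
  δ-diag zero    = refl
  δ-diag (suc k) = δ-diag k

  δ-off : ∀ k r → k ≢ r → δ k r ≈ 0#
  δ-off k r k≢r with k ℕ.≡ᵇ r in k≡ᵇr
  ... | false = refl
  ... | true  = ⊥-elim (k≢r (ℕ.≡ᵇ⇒≡ k r (≡.subst Bool.T (≡.sym k≡ᵇr) _)))

  bell-idSeries : ∀ k n → bell idSeries k n ≈ δ k n
  bell-idSeries zero    zero    = refl
  bell-idSeries zero    (suc n) = refl
  bell-idSeries (suc k) zero    = refl
  bell-idSeries (suc k) (suc n) = begin
    (D idSeries ⊕ bell idSeries k) n ≈⟨ ⊕-congʳ (bell idSeries k) D-idSeries n ⟩
    (1ˢ ⊕ bell idSeries k) n         ≈⟨ ⊕-identityˡ (bell idSeries k) n ⟩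
    bell idSeries k n                ≈⟨ bell-idSeries k n ⟩
    δ k n                            ∎
    where
    D-idSeries : D idSeries ≈ˢ 1ˢ
    D-idSeries zero    = refl
    D-idSeries (suc n) = refl

  compose-identityʳ : ∀ g → compose g idSeries ≈ˢ g
  compose-identityʳ g n = begin
    compose g idSeries n         ≈⟨ Σ-cong n (λ k → *-congˡ (bell-idSeries k n)) ⟩
    sumTo n (λ k → g k * δ k n)  ≈⟨ Σ-last n (λ k k<n →
                                       trans (*-congˡ (δ-off k n (ℕ.<⇒≢ k<n))) (zeroʳ _)) ⟩
    g n * δ n n                  ≈⟨ trans (*-congˡ (δ-diag n)) (*-identityʳ _) ⟩
    g n                          ∎

  compose-δ : ∀ k h → compose (δ k) h ≈ˢ bell h k
  compose-δ k h n with k ℕ.≤? n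
  ... | yes k≤n = trans
    (Σ-single n k k≤n (λ i _ i≢k → trans (*-congʳ (δ-off k i (i≢k ∘ ≡.sym))) (zeroˡ _)))
    (trans (*-congʳ (δ-diag k)) (*-identityˡ _))
  ... | no k≰n = trans
    (Σ-zero n (λ i i≤n → trans
      (*-congʳ (δ-off k i (λ k≡i → k≰n (≡.subst (_≤ n) (≡.sym k≡i) i≤n))))
      (zeroˡ _)))
    (sym (bell-vanish h k n (ℕ.≰⇒> k≰n)))

  -- Reciprocal, exponential and logarithm

  chi-⊕ : ∀ y n → (chi ⊕ y) n ≈ y n + n ×ₙ y (pred n)
  chi-⊕ y zero = trans (⊕-zero-index chi y) (trans (*-identityˡ _) (sym (+-identityʳ _)))
  chi-⊕ y (suc n) = begin
    (chi ⊕ y) (suc n)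
      ≈⟨ Σ-unfoldˡ n _ ⟩
    1 ×ₙ (1# * y (suc n)) + sumTo n (λ i → (suc n C suc i) ×ₙ (chi (suc i) * y (n ∸ i)))
      ≈⟨ +-cong (trans (×ₙ-homo-1 _) (*-identityˡ _)) (Σ-head n (λ { (suc i) _ _ →
           ×ₙ-vanish (suc n C suc (suc i)) (zeroˡ _) })) ⟩
    y (suc n) + (suc n C 1) ×ₙ (1# * y n)
      ≈⟨ +-congˡ (trans (×ₙ-congˡ (nC1≡n (suc n)) _) (×ₙ-congʳ (suc n) (*-identityˡ _))) ⟩
    y (suc n) + suc n ×ₙ y n
      ∎

  compose-chi : ∀ x → x 0 ≈ 1# → compose chi x ≈ˢ x
  compose-chi x x₀≈1 zero = trans (*-identityʳ _) (sym x₀≈1)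
  compose-chi x x₀≈1 (suc n) = begin
    compose chi x (suc n)
      ≈⟨ Σ-unfoldˡ n _ ⟩
    1# * 0# + sumTo n (λ k → chi (suc k) * bell x (suc k) (suc n))
      ≈⟨ +-cong (zeroʳ _) (Σ-head n (λ { (suc i) _ _ → zeroˡ _ })) ⟩
    0# + 1# * (D x ⊕ bell x 0) n
      ≈⟨ trans (+-identityˡ _) (*-identityˡ _) ⟩
    (D x ⊕ bell x 0) n
      ≈⟨ trans (⊕-congˡ (D x) (bell-zero x) n) (⊕-identityʳ (D x) n) ⟩
    x (suc n)
      ∎

  compose-1ˢ : ∀ x → compose 1ˢ x ≈ˢ 1ˢ
  compose-1ˢ x n =
    trans (Σ-head n (λ { (suc i) _ _ → zeroˡ _ })) (trans (*-identityˡ _) (bell-zero x n))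

  [1+t]⁻¹ : Seq
  [1+t]⁻¹ k = sgn k * ((k !) ×ₙ 1#)

  chi-⊕-[1+t]⁻¹ : (chi ⊕ [1+t]⁻¹) ≈ˢ 1ˢ
  chi-⊕-[1+t]⁻¹ zero =
    trans (chi-⊕ [1+t]⁻¹ 0) (trans (+-identityʳ _) (trans (*-identityˡ _) (+-identityʳ _)))
  chi-⊕-[1+t]⁻¹ (suc n) = begin
    (chi ⊕ [1+t]⁻¹) (suc n)
      ≈⟨ chi-⊕ [1+t]⁻¹ (suc n) ⟩
    - s * ((suc n ℕ.* (n !)) ×ₙ 1#) + suc n ×ₙ (s * ((n !) ×ₙ 1#))
      ≈⟨ +-cong (sym (-‿distribˡ-* s _))
                (trans (sym (×ₙ-comm-* (suc n) s _)) (*-congˡ (×ₙ-assocˡ 1# (suc n) (n !)))) ⟩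
    - (s * ((suc n ℕ.* (n !)) ×ₙ 1#)) + s * ((suc n ℕ.* (n !)) ×ₙ 1#)
      ≈⟨ -‿inverseˡ _ ⟩
    0#
      ∎
    where s = sgn n

  neg1-inverseʳ : ∀ x → x 0 ≈ 1# → (x ⊕ neg1 x) ≈ˢ 1ˢ
  neg1-inverseʳ x x₀≈1 n = begin
    (x ⊕ neg1 x) n                         ≈⟨ ⊕-congʳ (neg1 x) (compose-chi x x₀≈1) n ⟨
    (compose chi x ⊕ compose [1+t]⁻¹ x) n  ≈⟨ compose-homo-⊕ x chi [1+t]⁻¹ n ⟨
    compose (chi ⊕ [1+t]⁻¹) x n            ≈⟨ compose-congʳ x chi-⊕-[1+t]⁻¹ n ⟩
    compose 1ˢ x n                         ≈⟨ compose-1ˢ x n ⟩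
    1ˢ n                                   ∎

  neg1-inverseˡ : ∀ x → x 0 ≈ 1# → (neg1 x ⊕ x) ≈ˢ 1ˢ
  neg1-inverseˡ x x₀≈1 n = trans (⊕-comm (neg1 x) x n) (neg1-inverseʳ x x₀≈1 n)

  neg1-zero-index : ∀ x → neg1 x 0 ≈ 1#
  neg1-zero-index x = trans (compose-zero-index [1+t]⁻¹ x) (trans (*-identityˡ _) (+-identityʳ _))

  neg1-involutive : ∀ x → x 0 ≈ 1# → neg1 (neg1 x) ≈ˢ x
  neg1-involutive x x₀≈1 n = begin
    neg1 y n                ≈⟨ ⊕-identityˡ (neg1 y) n ⟨
    (1ˢ ⊕ neg1 y) n         ≈⟨ ⊕-congʳ (neg1 y) (neg1-inverseʳ x x₀≈1) n ⟨
    ((x ⊕ y) ⊕ neg1 y) n    ≈⟨ ⊕-assoc x y (neg1 y) n ⟩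
    (x ⊕ (y ⊕ neg1 y)) n    ≈⟨ ⊕-congˡ x (neg1-inverseʳ y (neg1-zero-index x)) n ⟩
    (x ⊕ 1ˢ) n              ≈⟨ ⊕-identityʳ x n ⟩
    x n                     ∎
    where
    y : Seq
    y = neg1 x

  ode-unique : ∀ c y z → y 0 ≈ z 0 → D y ≈ˢ (c ⊕ y) → D z ≈ˢ (c ⊕ z) → y ≈ˢ z
  ode-unique c y z y₀≈z₀ y'≈cy z'≈cz n = agree n n ℕ.≤-refl
    where
    agree : ∀ n → y ≈[ n ] z
    agree n       zero    _         = y₀≈z₀
    agree (suc n) (suc m) (s≤s m≤n) = trans (y'≈cy m) (trans
      (⊕-cong-≤ m {c} (λ _ _ → refl) (λ i i≤m → agree n i (ℕ.≤-trans i≤m m≤n)))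
      (sym (z'≈cz m)))

  eᵗ : Seq
  eᵗ _ = 1#

  logS-suc : ∀ x n → logS x (suc n) ≈ (D x ⊕ neg1 x) n
  logS-suc x = compose-chain _ x

  -- Both sides solve y' = (u'/u) y with y(0) = 1.
  exp∘log : ∀ u → u 0 ≈ 1# → compose eᵗ (logS u) ≈ˢ u
  exp∘log u u₀≈1 = ode-unique (D u ⊕ neg1 u) (compose eᵗ (logS u)) u
    (trans (compose-zero-index eᵗ (logS u)) (sym u₀≈1)) exp'≈ u'≈
    where
    exp'≈ : D (compose eᵗ (logS u)) ≈ˢ ((D u ⊕ neg1 u) ⊕ compose eᵗ (logS u))
    exp'≈ m = trans (compose-chain eᵗ (logS u) m) (⊕-congʳ (compose eᵗ (logS u)) (logS-suc u) m)
    u'≈ : D u ≈ˢ ((D u ⊕ neg1 u) ⊕ u)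
    u'≈ m = begin
      D u m                    ≈⟨ ⊕-identityʳ (D u) m ⟨
      (D u ⊕ 1ˢ) m             ≈⟨ ⊕-congˡ (D u) (neg1-inverseˡ u u₀≈1) m ⟨
      (D u ⊕ (neg1 u ⊕ u)) m   ≈⟨ ⊕-assoc (D u) (neg1 u) u m ⟨
      ((D u ⊕ neg1 u) ⊕ u) m   ∎

  log∘exp : ∀ h → h 0 ≈ 0# → logS (compose eᵗ h) ≈ˢ h
  log∘exp h h₀≈0 zero = trans (*-identityʳ _) (sym h₀≈0)
  log∘exp h h₀≈0 (suc n) = begin
    logS y (suc n)           ≈⟨ logS-suc y n ⟩
    (D y ⊕ neg1 y) n         ≈⟨ ⊕-congʳ (neg1 y) (compose-chain eᵗ h) n ⟩
    ((D h ⊕ y) ⊕ neg1 y) n   ≈⟨ ⊕-assoc (D h) y (neg1 y) n ⟩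
    (D h ⊕ (y ⊕ neg1 y)) n   ≈⟨ ⊕-congˡ (D h) (neg1-inverseʳ y (compose-zero-index eᵗ h)) n ⟩
    (D h ⊕ 1ˢ) n             ≈⟨ ⊕-identityʳ (D h) n ⟩
    h (suc n)                ∎
    where
    y : Seq
    y = compose eᵗ h

  -- f(β,t) = exp(e^t − 1), and e^t − 1 composed with log(1 + h) is h.
  star≈exp : ∀ h → star h ≈ˢ compose eᵗ h
  star≈exp h n = trans (compose-assoc eᵗ eᵗ (logS (compInvUmbra h)) n)
    (compose-congˡ eᵗ (λ m → exp∘log (compInvUmbra h) refl (suc m)) n)

  log-star : ∀ h → h 0 ≈ 0# → logS (star h) ≈ˢ h
  log-star h h₀≈0 n = trans (compose-congˡ _ (λ m → star≈exp h (suc m)) n) (log∘exp h h₀≈0 n)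

  -- Moment sequences with values in R[x]

  _P*_ : P.Pol → P.Pol → P.Pol
  _P*_ = RawRing._*_ P.polyRawRing

  1ᴾ : P.Pol
  1ᴾ = RawRing.1# P.polyRawRing

  column : PSeq → ℕ → Seq
  column X k m = X m k

  const≈*1ˢ : ∀ a k → P.const a k ≈ a * 1ˢ k
  const≈*1ˢ a zero    = sym (*-identityʳ a)
  const≈*1ˢ a (suc k) = sym (zeroʳ a)

  const-cong : ∀ {a b} → a ≈ b → ∀ k → P.const a k ≈ P.const b k
  const-cong a≈b zero    = a≈b
  const-cong a≈b (suc k) = refl

  1ᴾ≈1ˢ : ∀ k → 1ᴾ k ≈ 1ˢ k
  1ᴾ≈1ˢ zero    = refl
  1ᴾ≈1ˢ (suc k) = refl

  EP-Σ : ∀ n (F : ℕ → P.Pol) k → EP.sumTo n F k ≈ sumTo n (λ i → F i k)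
  EP-Σ zero    F k = refl
  EP-Σ (suc n) F k = +-congʳ (EP-Σ n F k)

  EP-×ₙ : ∀ m (p : P.Pol) k → (m EP.×ₙ p) k ≈ m ×ₙ p k
  EP-×ₙ zero    p k = refl
  EP-×ₙ (suc m) p k = +-congˡ (EP-×ₙ m p k)

  P*-cong : ∀ {p p' q q' : P.Pol} → (∀ i → p i ≈ p' i) → (∀ i → q i ≈ q' i) →
    ∀ k → (p P* q) k ≈ (p' P* q') k
  P*-cong p≈p' q≈q' k = Σ-cong k (λ i → *-cong (p≈p' i) (q≈q' (k ∸ i)))

  const-P*ˡ : ∀ a p k → (P.const a P* p) k ≈ a * p k
  const-P*ˡ a p k = Σ-head k (λ { (suc i) _ _ → zeroˡ _ })

  const-P*ʳ : ∀ p a k → (p P* P.const a) k ≈ p k * a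
  const-P*ʳ p a k = trans
    (Σ-last k (λ i i<k → trans (*-congˡ (const-pos (k ∸ i) (ℕ.m<n⇒0<n∸m i<k))) (zeroʳ _)))
    (*-congˡ (reflexive (≡.cong (P.const a) (ℕ.n∸n≡0 k))))
    where
    const-pos : ∀ m → 0 < m → P.const a m ≈ 0#
    const-pos (suc m) _ = refl

  EP-bell : ∀ {X x} → X ≡ᵤ embed x → ∀ m → EP.bell X m ≡ᵤ embed (bell x m)
  EP-bell X≈x zero    zero    zero    = refl
  EP-bell X≈x zero    zero    (suc k) = refl
  EP-bell X≈x zero    (suc n) zero    = refl
  EP-bell X≈x zero    (suc n) (suc k) = refl
  EP-bell X≈x (suc m) zero    zero    = refl
  EP-bell X≈x (suc m) zero    (suc k) = refl
  EP-bell {X} {x} X≈x (suc m) (suc n) k = begin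
    EP.bell X (suc m) (suc n) k
      ≈⟨ EP-Σ n _ k ⟩
    sumTo n (λ i → ((n C i) EP.×ₙ (X (suc i) P* EP.bell X m (n ∸ i))) k)
      ≈⟨ Σ-cong n (λ i → trans (EP-×ₙ (n C i) _ k) (×ₙ-congʳ (n C i) (term i))) ⟩
    sumTo n (λ i → (n C i) ×ₙ ((x (suc i) * bell x m (n ∸ i)) * 1ˢ k))
      ≈⟨ Σ-cong n (λ i → sym (×ₙ-assoc-* (n C i) _ _)) ⟩
    sumTo n (λ i → ((n C i) ×ₙ (x (suc i) * bell x m (n ∸ i))) * 1ˢ k)
      ≈⟨ trans (sym (Σ-distribʳ-* n _ _)) (sym (const≈*1ˢ _ k)) ⟩
    P.const (bell x (suc m) (suc n)) k
      ∎
    where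
    term : ∀ i → (X (suc i) P* EP.bell X m (n ∸ i)) k ≈ (x (suc i) * bell x m (n ∸ i)) * 1ˢ k
    term i = begin
      (X (suc i) P* EP.bell X m (n ∸ i)) k
        ≈⟨ P*-cong (X≈x (suc i)) (EP-bell X≈x m (n ∸ i)) k ⟩
      (P.const (x (suc i)) P* P.const (bell x m (n ∸ i))) k
        ≈⟨ const-P*ˡ (x (suc i)) (P.const (bell x m (n ∸ i))) k ⟩
      x (suc i) * P.const (bell x m (n ∸ i)) k
        ≈⟨ trans (*-congˡ (const≈*1ˢ _ k)) (sym (*-assoc _ _ _)) ⟩
      (x (suc i) * bell x m (n ∸ i)) * 1ˢ k
        ∎

  EP-compose : ∀ G {X x} → X ≡ᵤ embed x → ∀ n k → EP.compose G X n k ≈ compose (column G k) x n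
  EP-compose G {X} {x} X≈x n k = trans (EP-Σ n _ k) (Σ-cong n (λ m →
    trans (P*-cong {G m} (λ _ → refl) (EP-bell X≈x m n) k) (const-P*ʳ (G m) _ k)))

  EP-⊕ : ∀ {X x} → X ≡ᵤ embed x → ∀ Y n k → EP._⊕_ X Y n k ≈ (x ⊕ column Y k) n
  EP-⊕ {X} {x} X≈x Y n k = trans (EP-Σ n _ k) (Σ-cong n (λ j → trans (EP-×ₙ (n C j) _ k)
    (×ₙ-congʳ (n C j) (trans (P*-cong {q = Y (n ∸ j)} (X≈x j) (λ _ → refl) k)
                             (const-P*ˡ (x j) (Y (n ∸ j)) k)))))

  EP-sgn : ∀ m k → EP.sgn m k ≈ sgn m * 1ˢ k
  EP-sgn zero    k = trans (1ᴾ≈1ˢ k) (sym (*-identityˡ _))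
  EP-sgn (suc m) k = trans (-‿cong (EP-sgn m k)) (-‿distribˡ-* _ _)

  EP-[1+t]⁻¹ : ∀ m k → (EP.sgn m P* ((m !) EP.×ₙ 1ᴾ)) k ≈ [1+t]⁻¹ m * 1ˢ k
  EP-[1+t]⁻¹ m k = begin
    (EP.sgn m P* ((m !) EP.×ₙ 1ᴾ)) k
      ≈⟨ P*-cong {q = (m !) EP.×ₙ 1ᴾ} (λ i → trans (EP-sgn m i) (sym (const≈*1ˢ _ i)))
                                    (λ _ → refl) k ⟩
    (P.const (sgn m) P* ((m !) EP.×ₙ 1ᴾ)) k
      ≈⟨ const-P*ˡ (sgn m) ((m !) EP.×ₙ 1ᴾ) k ⟩
    sgn m * ((m !) EP.×ₙ 1ᴾ) k
      ≈⟨ *-congˡ (trans (EP-×ₙ (m !) _ k)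
           (trans (×ₙ-congʳ (m !) (trans (1ᴾ≈1ˢ k) (sym (*-identityˡ _))))
                  (sym (×ₙ-assoc-* (m !) 1# _)))) ⟩
    sgn m * (((m !) ×ₙ 1#) * 1ˢ k)
      ≈⟨ *-assoc _ _ _ ⟨
    [1+t]⁻¹ m * 1ˢ k
      ∎

  EP-neg1 : ∀ x → EP.neg1 (embed x) ≡ᵤ embed (neg1 x)
  EP-neg1 x n k = begin
    EP.neg1 (embed x) n k
      ≈⟨ EP-compose _ (λ _ _ → refl) n k ⟩
    compose (λ m → (EP.sgn m P* ((m !) EP.×ₙ 1ᴾ)) k) x n
      ≈⟨ compose-congʳ x (λ m → EP-[1+t]⁻¹ m k) n ⟩
    compose (λ m → [1+t]⁻¹ m * 1ˢ k) x n
      ≈⟨ compose-*ʳ [1+t]⁻¹ x (1ˢ k) n ⟩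
    neg1 x n * 1ˢ k
      ≈⟨ const≈*1ˢ _ k ⟨
    P.const (neg1 x n) k
      ∎

  log[1+t] : Seq
  log[1+t] zero    = 0#
  log[1+t] (suc j) = [1+t]⁻¹ j

  EP-logS : ∀ {X x} → X ≡ᵤ embed x → EP.logS X ≡ᵤ embed (logS x)
  EP-logS {X} {x} X≈x n k = begin
    EP.logS X n k
      ≈⟨ EP-compose _ X≈x n k ⟩
    compose _ x n
      ≈⟨ compose-congʳ x (λ { zero → sym (zeroˡ _) ; (suc j) → EP-[1+t]⁻¹ j k }) n ⟩
    compose (λ m → log[1+t] m * 1ˢ k) x n
      ≈⟨ compose-*ʳ log[1+t] x (1ˢ k) n ⟩
    compose log[1+t] x n * 1ˢ k
      ≈⟨ *-congʳ (compose-congʳ x (λ { zero → refl ; (suc j) → refl }) n) ⟩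
    logS x n * 1ˢ k
      ≈⟨ const≈*1ˢ _ k ⟨
    P.const (logS x n) k
      ∎

  -- Sheffer sequences satisfy the condition

  -- The t^n/n! coefficient of A(t) h(t)^k/k!, i.e. of x^k in A(t) exp(x h(t)).
  sheffer : Seq → Seq → ℕ → ℕ → Carrier
  sheffer A h n k = (A ⊕ bell h k) n

  sheffer-vanish : ∀ A h n k → n < k → sheffer A h n k ≈ 0#
  sheffer-vanish A h n k n<k = Σ-zero n (λ j _ → ×ₙ-vanish (n C j)
    (trans (*-congˡ (bell-vanish h k (n ∸ j) (ℕ.≤-<-trans (ℕ.m∸n≤m n j) n<k))) (zeroʳ _)))

  sheffer-constant : ∀ A h n → sheffer A h n 0 ≈ A n
  sheffer-constant A h n = trans (⊕-congˡ A (bell-zero h) n) (⊕-identityʳ A n)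

  shefferMoments≈sheffer : ∀ α h → h 0 ≈ 0# →
    shefferMoments α h ≡ᵤ sheffer (compose (neg1 α) h) h
  shefferMoments≈sheffer α h h₀≈0 n k = begin
    shefferMoments α h n k
      ≈⟨ EP-compose G log-γ*≈h n k ⟩
    compose (column G k) h n
      ≈⟨ compose-congʳ h (λ m → EP-⊕ (EP-neg1 α) xu m k) n ⟩
    compose (neg1 α ⊕ δ k) h n
      ≈⟨ compose-homo-⊕ h (neg1 α) (δ k) n ⟩
    (compose (neg1 α) h ⊕ compose (δ k) h) n
      ≈⟨ ⊕-congˡ (compose (neg1 α) h) (compose-δ k h) n ⟩
    (compose (neg1 α) h ⊕ bell h k) n
      ∎
    where
    G : PSeq
    G = EP._⊕_ (EP.neg1 (embed α)) xu
    log-γ*≈h : EP.logS (embed (star h)) ≡ᵤ embed h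
    log-γ*≈h j k = trans (EP-logS (λ _ _ → refl) j k) (const-cong (log-star h h₀≈0 j) k)

  -- The coefficient of x^k in E[s_n(η + x)].
  shifted : (ℕ → ℕ → Carrier) → Seq → ℕ → ℕ → Carrier
  shifted s η n k = sumTo n (λ m → s n m * (η ⊕ δ k) m)

  chi+ : (ℕ → ℕ → Carrier) → ℕ → ℕ → Carrier
  chi+ s n k = (chi ⊕ column s k) n

  substUmbra≈shifted : ∀ s η → substUmbra s (EP._⊕_ (embed η) xu) ≡ᵤ shifted s η
  substUmbra≈shifted s η n k = trans (EP-Σ n _ k) (Σ-cong n (λ m →
    trans (const-P*ˡ (s n m) (EP._⊕_ (embed η) xu m) k) (*-congˡ (EP-⊕ (λ _ _ → refl) xu m k))))

  embed-chi≈chi+ : ∀ s → EP._⊕_ (embed chi) s ≡ᵤ chi+ s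
  embed-chi≈chi+ s = EP-⊕ (λ _ _ → refl) s

  Σ-sheffer : ∀ A h c n → sumTo n (λ m → sheffer A h n m * c m) ≈ (A ⊕ compose c h) n
  Σ-sheffer A h c n = begin
    sumTo n (λ m → (A ⊕ bell h m) n * c m)
      ≈⟨ Σ-cong n (λ m → trans (Σ-distribʳ-* n (c m) _) (Σ-cong n (λ j →
           trans (×ₙ-assoc-* (n C j) _ (c m)) (×ₙ-congʳ (n C j) (xy*z≈x*zy _ _ _))))) ⟩
    sumTo n (λ m → sumTo n (λ j → (n C j) ×ₙ (A j * (c m * bell h m (n ∸ j)))))
      ≈⟨ Σ-comm n n _ ⟩
    sumTo n (λ j → sumTo n (λ m → (n C j) ×ₙ (A j * (c m * bell h m (n ∸ j)))))
      ≈⟨ Σ-cong-≤ n (λ j j≤n → trans (sym (×ₙ-distrib-Σ n (n C j) _)) (×ₙ-congʳ (n C j)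
           (trans (sym (Σ-distribˡ-* n (A j) _))
                  (*-congˡ (compose-extend c h (n ∸ j) n (ℕ.m∸n≤m n j)))))) ⟩
    (A ⊕ compose c h) n
      ∎

  compose-η≈chi : ∀ η h → η 0 ≈ 1# → (∀ n → compose (fMinus1 η) h n ≈ idSeries n) →
    compose η h ≈ˢ chi
  compose-η≈chi η h η₀≈1 η∘h≈t n = begin
    compose η h n                          ≈⟨ compose-congʳ h η≈ n ⟩
    compose (fMinus1 η +ˢ 1ˢ) h n          ≈⟨ compose-distrib-+ (fMinus1 η) 1ˢ h n ⟩
    compose (fMinus1 η) h n + compose 1ˢ h n ≈⟨ +-cong (η∘h≈t n) (compose-1ˢ h n) ⟩
    idSeries n + 1ˢ n                      ≈⟨ t+1≈chi n ⟩
    chi n                                  ∎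
    where
    η≈ : η ≈ˢ (fMinus1 η +ˢ 1ˢ)
    η≈ zero    = trans η₀≈1 (sym (+-identityˡ _))
    η≈ (suc n) = sym (+-identityʳ _)
    t+1≈chi : ∀ n → idSeries n + 1ˢ n ≈ chi n
    t+1≈chi zero          = +-identityˡ _
    t+1≈chi (suc zero)    = +-identityʳ _
    t+1≈chi (suc (suc n)) = +-identityʳ _

  sheffer-shifted : ∀ A h η → η 0 ≈ 1# → (∀ n → compose (fMinus1 η) h n ≈ idSeries n) →
    shifted (sheffer A h) η ≡ᵤ chi+ (sheffer A h)
  sheffer-shifted A h η η₀≈1 η∘h≈t n k = begin
    shifted (sheffer A h) η n k
      ≈⟨ Σ-sheffer A h (η ⊕ δ k) n ⟩
    (A ⊕ compose (η ⊕ δ k) h) n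
      ≈⟨ ⊕-congˡ A (compose-homo-⊕ h η (δ k)) n ⟩
    (A ⊕ (compose η h ⊕ compose (δ k) h)) n
      ≈⟨ ⊕-congˡ A (⊕-congʳ (compose (δ k) h) (compose-η≈chi η h η₀≈1 η∘h≈t)) n ⟩
    (A ⊕ (chi ⊕ compose (δ k) h)) n
      ≈⟨ ⊕-congˡ A (⊕-congˡ chi (compose-δ k h)) n ⟩
    (A ⊕ (chi ⊕ bell h k)) n
      ≈⟨ ⊕-swapˡ A chi (bell h k) n ⟩
    chi+ (sheffer A h) n k
      ∎

  -- The condition determines the sequence

  ⊕-δ : ∀ x k m → k ≤ m → (x ⊕ δ k) m ≈ (m C (m ∸ k)) ×ₙ x (m ∸ k)
  ⊕-δ x k m k≤m = trans
    (Σ-single m (m ∸ k) (ℕ.m∸n≤m m k) (λ j j≤m j≢m∸k → ×ₙ-vanish (m C j)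
      (trans (*-congˡ (δ-off k (m ∸ j) (λ k≡m∸j → j≢m∸k
               (≡.trans (≡.sym (ℕ.m∸[m∸n]≡n j≤m)) (≡.cong (m ∸_) (≡.sym k≡m∸j))))))
             (zeroʳ _))))
    (×ₙ-congʳ (m C (m ∸ k)) (trans
      (*-congˡ (trans (reflexive (≡.cong (δ k) (ℕ.m∸[m∸n]≡n k≤m))) (δ-diag k)))
      (*-identityʳ _)))

  ⊕-δ-vanish : ∀ x k m → m < k → (x ⊕ δ k) m ≈ 0#
  ⊕-δ-vanish x k m m<k = Σ-zero m (λ j _ → ×ₙ-vanish (m C j)
    (trans (*-congˡ (δ-off k (m ∸ j) (λ k≡m∸j →
             ℕ.<⇒≢ (ℕ.≤-<-trans (ℕ.m∸n≤m m j) m<k) (≡.sym k≡m∸j))))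
           (zeroʳ _)))

  ⊕-δ-diag : ∀ x k → (x ⊕ δ k) k ≈ x 0
  ⊕-δ-diag x k = trans (⊕-δ x k k ℕ.≤-refl)
    (trans (reflexive (≡.cong (λ j → (k C j) ×ₙ x j) (ℕ.n∸n≡0 k))) (×ₙ-homo-1 (x 0)))

  ⊕-δ-super : ∀ x k → (x ⊕ δ k) (suc k) ≈ suc k ×ₙ x 1
  ⊕-δ-super x k = trans (⊕-δ x k (suc k) (ℕ.n≤1+n k))
    (trans (reflexive (≡.cong (λ j → (suc k C j) ×ₙ x j) (ℕ.m+n∸n≡m 1 k)))
           (×ₙ-congˡ (nC1≡n (suc k)) (x 1)))

  x*[1+j]y≈0⇒x≈0 : IsIntegralDomain → QuotientFieldCharZero →
    ∀ {y} → ¬ y ≈ 0# → ∀ j x → x * (suc j ×ₙ y) ≈ 0# → x ≈ 0#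
  x*[1+j]y≈0⇒x≈0 (_ , no-zero-divisors) char0 {y} y≉0 j x xjy≈0
    with no-zero-divisors x _ xjy≈0
  ... | inj₁ x≈0  = x≈0
  ... | inj₂ jy≈0 with no-zero-divisors (suc j ×ₙ 1#) y
         (trans (×ₙ-assoc-* (suc j) 1# y) (trans (×ₙ-congʳ (suc j) (*-identityˡ y)) jy≈0))
  ...   | inj₁ j≈0 = ⊥-elim (char0 j j≈0)
  ...   | inj₂ y≈0 = ⊥-elim (y≉0 y≈0)

  [x+z]-[y+z]≈x-y : ∀ x y z → (x + z) - (y + z) ≈ x - y
  [x+z]-[y+z]≈x-y x y z = begin
    (x + z) - (y + z)      ≈⟨ +-congˡ (-‿+-comm y z) ⟨
    (x + z) + (- y + - z)  ≈⟨ interchange x z (- y) (- z) ⟩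
    (x - y) + (z - z)      ≈⟨ trans (+-congˡ (-‿inverseʳ z)) (+-identityʳ _) ⟩
    x - y                  ∎

  module _ (dom : IsIntegralDomain) (char0 : QuotientFieldCharZero)
           {η : Seq} (η₀≈1 : η 0 ≈ 1#) (η₁≉0 : ¬ η 1 ≈ 0#) where

    shifted-kernel : ∀ n d → (∀ m → n < m → d m ≈ 0#) → d 0 ≈ 0# →
      (∀ k → sumTo n (λ m → d m * (η ⊕ δ k) m) ≈ d k) → d ≈ˢ 0ˢ
    shifted-kernel n d d-deg d₀≈0 d-fixed zero    = d₀≈0
    shifted-kernel n d d-deg d₀≈0 d-fixed (suc j) = descend n ℕ.≤-refl d-deg (suc j) (s≤s z≤n)
      where
      VanishesAbove : ℕ → Set ℓ
      VanishesAbove i = ∀ m → i < m → d m ≈ 0#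
      -- Row j of the system reduces to d j + d (j+1) · (j+1) η₁ = d j.
      next : ∀ j → suc j ≤ n → VanishesAbove (suc j) → d (suc j) ≈ 0#
      next j j<n above = x*[1+j]y≈0⇒x≈0 dom char0 η₁≉0 j (d (suc j))
        (+-identityʳ-unique (d j) _ (trans (sym row-j) (d-fixed j)))
        where
        row-j : sumTo n (λ m → d m * (η ⊕ δ j) m) ≈ d j + d (suc j) * (suc j ×ₙ η 1)
        row-j = trans
          (Σ-truncate n j<n (λ m j+1<m _ → trans (*-congʳ (above m j+1<m)) (zeroˡ _)))
          (+-cong (trans (Σ-last j (λ m m<j → trans (*-congˡ (⊕-δ-vanish η j m m<j)) (zeroʳ _)))
                         (trans (*-congˡ (trans (⊕-δ-diag η j) η₀≈1)) (*-identityʳ _)))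
                  (*-congˡ (⊕-δ-super η j)))
      descend : ∀ i → i ≤ n → VanishesAbove i → VanishesAbove 0
      descend zero    _   above = above
      descend (suc j) j<n above = descend j (ℕ.<⇒≤ j<n) above-j
        where
        above-j : VanishesAbove j
        above-j m j<m with ℕ.m≤n⇒m<n∨m≡n j<m
        ... | inj₁ j+1<m = above m j+1<m
        ... | inj₂ ≡.refl = next j j<n above

    shifted-unique : ∀ s t → shifted s η ≡ᵤ chi+ s → shifted t η ≡ᵤ chi+ t →
      (∀ n m → n < m → s n m ≈ 0#) → (∀ n m → n < m → t n m ≈ 0#) →
      (∀ n → s n 0 ≈ t n 0) → s ≡ᵤ t
    shifted-unique s t s-shift t-shift s-deg t-deg s≈t-const = rows
      where
      row : ∀ n → (∀ k → n ×ₙ s (pred n) k ≈ n ×ₙ t (pred n) k) → ∀ k → s n k ≈ t n k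
      row n prev≈ k = x∙y⁻¹≈ε⇒x≈y _ _ (shifted-kernel n (λ m → s n m - t n m)
        (λ m n<m → x≈y⇒x∙y⁻¹≈ε (trans (s-deg n m n<m) (sym (t-deg n m n<m))))
        (x≈y⇒x∙y⁻¹≈ε (s≈t-const n)) fixed k)
        where
        fixed : ∀ k → sumTo n (λ m → (s n m - t n m) * (η ⊕ δ k) m) ≈ s n k - t n k
        fixed k = begin
          sumTo n (λ m → (s n m - t n m) * (η ⊕ δ k) m)
            ≈⟨ trans (Σ-cong n (λ m → [y-z]x≈yx-zx _ _ _)) (Σ-distrib-sub n _ _) ⟩
          shifted s η n k - shifted t η n k
            ≈⟨ +-cong (trans (s-shift n k) (chi-⊕ (column s k) n))
                      (-‿cong (trans (t-shift n k) (chi-⊕ (column t k) n))) ⟩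
          (s n k + n ×ₙ s (pred n) k) - (t n k + n ×ₙ t (pred n) k)
            ≈⟨ +-congˡ (-‿cong (+-congˡ (sym (prev≈ k)))) ⟩
          (s n k + n ×ₙ s (pred n) k) - (t n k + n ×ₙ s (pred n) k)
            ≈⟨ [x+z]-[y+z]≈x-y _ _ _ ⟩
          s n k - t n k
            ∎
      rows : s ≡ᵤ t
      rows zero    = row 0 (λ _ → refl)
      rows (suc n) = row (suc n) (λ k → ×ₙ-congʳ (suc n) (rows n k))

  sheffer⇒condition : ∀ s → IsSheffer s → SheffCondition s
  sheffer⇒condition s (α , γ , h , _ , γ₀≈1 , γ₁≉0 , γ-inv@(h₀≈0 , γ∘h≈t , _) , s≈) =
    γ , γ₀≈1 , (γ₁≉0 , h , γ-inv) , λ n k → begin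
      substUmbra s (EP._⊕_ (embed γ) xu) n k ≈⟨ substUmbra≈shifted s γ n k ⟩
      shifted s γ n k                       ≈⟨ Σ-cong n (λ m → *-congʳ (s≈S n m)) ⟩
      shifted S γ n k                       ≈⟨ sheffer-shifted A h γ γ₀≈1 γ∘h≈t n k ⟩
      chi+ S n k                            ≈⟨ ⊕-congˡ chi (λ r → s≈S r k) n ⟨
      chi+ s n k                            ≈⟨ embed-chi≈chi+ s n k ⟨
      EP._⊕_ (embed chi) s n k              ∎
    where
    A : Seq
    A = compose (neg1 α) h
    S : ℕ → ℕ → Carrier
    S = sheffer A h
    s≈S : s ≡ᵤ S
    s≈S n k = trans (s≈ n k) (shefferMoments≈sheffer α h h₀≈0 n k)

  condition⇒sheffer : IsIntegralDomain → QuotientFieldCharZero →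
    ∀ s → PolynomialUmbra s → SheffCondition s → IsSheffer s
  condition⇒sheffer dom char0 s (s₀₀≈1 , s-deg , _)
                    (η , η₀≈1 , (η₁≉0 , h , η-inv@(h₀≈0 , η∘h≈t , _)) , cond) =
    neg1 a , η , h , neg1-zero-index a , η₀≈1 , η₁≉0 , η-inv , λ n k → begin
      s n k                                      ≈⟨ s≈S n k ⟩
      sheffer S₀ h n k                           ≈⟨ ⊕-congʳ (bell h k) A≈S₀ n ⟨
      sheffer (compose (neg1 (neg1 a)) h) h n k  ≈⟨ shefferMoments≈sheffer (neg1 a) h h₀≈0 n k ⟨
      shefferMoments (neg1 a) h n k              ∎
    where
    -- α is chosen with f(α,t)⁻¹ = S₀(f(η,t) − 1), so that f(α,h(t))⁻¹ = S₀(t).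
    S₀ a : Seq
    S₀ = column s 0
    a  = compose S₀ (fMinus1 η)
    a₀≈1 : a 0 ≈ 1#
    a₀≈1 = trans (compose-zero-index S₀ (fMinus1 η)) s₀₀≈1
    A≈S₀ : compose (neg1 (neg1 a)) h ≈ˢ S₀
    A≈S₀ m = begin
      compose (neg1 (neg1 a)) h m          ≈⟨ compose-congʳ h (neg1-involutive a a₀≈1) m ⟩
      compose a h m                        ≈⟨ compose-assoc S₀ (fMinus1 η) h m ⟩
      compose S₀ (compose (fMinus1 η) h) m ≈⟨ compose-congˡ S₀ (λ i → η∘h≈t (suc i)) m ⟩
      compose S₀ idSeries m                ≈⟨ compose-identityʳ S₀ m ⟩
      S₀ m                                 ∎
    s≈S : s ≡ᵤ sheffer S₀ h
    s≈S = shifted-unique dom char0 η₀≈1 η₁≉0 s (sheffer S₀ h)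
      (λ n k → trans (sym (substUmbra≈shifted s η n k)) (trans (cond n k) (embed-chi≈chi+ s n k)))
      (sheffer-shifted S₀ h η η₀≈1 η∘h≈t)
      s-deg (sheffer-vanish S₀ h) (λ n → sym (sheffer-constant S₀ h n))

theorem5p4 : {c ℓ : Level} (R : CommutativeRing c ℓ) →
    Umbral.IsIntegralDomain R → Umbral.QuotientFieldCharZero R →
    (s : ℕ → ℕ → CommutativeRing.Carrier R) → Umbral.PolynomialUmbra R s →
    Umbral.IsSheffer R s ⇔ Umbral.SheffCondition R s
theorem5p4 R dom char0 s s-poly =
  mk⇔ (sheffer⇒condition R s) (condition⇒sheffer R dom char0 s s-poly)
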